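{- Let $n \ge 3$ and $R \subseteq \{2,\ldots,n-1\}$. If $S$ is a Hamilton sequence for the restricted rotator graph $\mathrm{Rot}_{n-1}(R)$ whose last two entries are both $n-1$, then for every $m \in \{2,3,\ldots,n\}$, $\mathrm{rewind}_m(S)$ (formed with parameter $n$) is a Hamilton sequence for the restricted incomplete rotator graph $\mathrm{Rot}_n(R \cup \{n\}, m)$.
   Context: $\Pi_k$ is the set of strings that are permutations of $\{1,\ldots,k\}$. For $2 \le r \le k$, the prefix-rotation $\sigma_r$ maps $a_1 \cdots a_k$ to $a_2 \cdots a_r a_1 a_{r+1} \cdots a_k$. For $R \subseteq \{2,\ldots,k\}$ and $m \in \{1,\ldots,k\}$, $\mathrm{Rot}_k(R,m)$ is the directed graph whose nodes are the strings of $\Pi_k$ whose last symbol is at most $m$, with an arc from $\mathbf{a}$ to $\mathbf{b}$ whenever both are nodes and $\mathbf{b} = \mathbf{a}\sigma_r$ for some $r \in R$; $\mathrm{Rot}_k(R) = \mathrm{Rot}_k(R,k)$. A Hamilton sequence for such a graph with $N$ nodes is a sequence $r_1,\ldots,r_N$ of elements of $R$ such that, with $v_0 = k\,(k{ - }1)\cdots 1$ and $v_i = v_{i-1}\sigma_{r_i}$, the strings $v_0,\ldots,v_{N-1}$ are pairwise distinct and are exactly the nodes, and $v_N = v_0$. Rewind operation: writing $S = T, n{ - }1, n{ - }1$, $\mathrm{rewind}_m(S)$ is the concatenation of: $T, n{ - }1, n$; then $m-2$ copies of the block $T, n$; then $T, n{ - }1, n$; then $m-2$ copies of $n$. -}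

module Defs where

open import Data.Nat using (ℕ; zero; suc; _∸_; _≤_)
open import Data.List using (List; []; _∷_; _++_; take; drop; applyUpTo; reverse; last; concat; replicate; foldl)
open import Data.List.Relation.Binary.Permutation.Propositional using (_↭_)
open import Data.List.Relation.Unary.All using (All)
open import Data.List.Relation.Unary.Unique.Propositional using (Unique)
open import Data.List.Membership.Propositional using (_∈_)
open import Data.Maybe using (just)
open import Data.Product using (_×_; ∃)
open import Relation.Binary.PropositionalEquality using (_≡_)
open import Function.Bundles using (_⇔_)

ascending : ℕ → List ℕ
ascending k = applyUpTo suc k

startString : ℕ → List ℕ
startString k = reverse (ascending k)

InΠ : ℕ → List ℕ → Set
InΠ k a = a ↭ ascending k

σ : ℕ → List ℕ → List ℕ
σ r []       = []
σ r (a ∷ as) = take (r ∸ 1) as ++ (a ∷ drop (r ∸ 1) as)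

Node : ℕ → ℕ → List ℕ → Set
Node k m a = InΠ k a × ∃ λ x → last a ≡ just x × x ≤ m

visited : List ℕ → List ℕ → List (List ℕ)
visited v []       = []
visited v (r ∷ rs) = v ∷ visited (σ r v) rs

final : List ℕ → List ℕ → List ℕ
final v rs = foldl (λ w r → σ r w) v rs

IsHamiltonSeq : ℕ → (ℕ → Set) → ℕ → List ℕ → Set
IsHamiltonSeq k R m S =
  All R S
  × Unique (visited (startString k) S)
  × (∀ a → a ∈ visited (startString k) S ⇔ Node k m a)
  × final (startString k) S ≡ startString k

-- rewind_m(S) with parameter n, where S = T, n-1, n-1
rewind : ℕ → ℕ → List ℕ → List ℕ
rewind n m T =
  T ++ (n ∸ 1 ∷ n ∷ [])
  ++ concat (replicate (m ∸ 2) (T ++ (n ∷ [])))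
  ++ T ++ (n ∸ 1 ∷ n ∷ [])
  ++ replicate (m ∸ 2) n

-- Put k = n - 1 and let C be the closed walk of Rot_k(R) that S = T, k, k traces from k⋯1.  The strings
-- of Π_n ending in c are the strings P c with P a permutation of the other symbols; relabelling k⋯1 to P
-- turns C into a closed walk through all of them, since σ_r with r ≤ k never moves the last symbol.
-- rewind_m(S) runs through these m copies of C: copies 1 and m completely, every copy 1 < c < m except
-- for the image of its last string, which is the rotation (c-1)⋯1 n⋯c of n⋯1.  On strings of length n,
-- σ_k Z = σ_n X implies σ_n Z = σ_k X, so each σ_n leaves a copy exactly at the entry point of the next
-- one, and the m - 2 trailing σ_n's rotate back to n⋯1 through precisely the skipped strings.  The
-- visited strings are therefore a rearrangement of the m copies of C.
module Submission where

open import Defs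
open import Data.Empty using (⊥-elim)
open import Data.List using (List; []; _∷_; _++_; _∷ʳ_; map; length; take; drop; last; concat; replicate; applyDownFrom; initLast; _∷ʳ′_)
open import Data.List.Membership.Propositional using (_∈_)
open import Data.List.Membership.Propositional.Properties using (∈-++⁺ˡ; ∈-++⁺ʳ; ∈-map⁺; ∈-map⁻; ∈-++⁻)
open import Data.List.Properties
open import Data.List.Relation.Binary.Disjoint.Propositional using (Disjoint)
open import Data.List.Relation.Binary.Permutation.Propositional using (_↭_; ↭-refl; ↭-sym; ↭-trans; ↭-reflexive; prep; ↭⇒↭ₛ; module PermutationReasoning)
import Data.List.Relation.Binary.Permutation.Propositional.Properties as ↭
import Data.List.Relation.Binary.Permutation.Setoid.Properties as ↭ₛ
open import Data.List.Relation.Unary.All using (All; []; _∷_)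
import Data.List.Relation.Unary.All as All
import Data.List.Relation.Unary.All.Properties as All
open import Data.List.Relation.Unary.AllPairs using ([]; _∷_)
open import Data.List.Relation.Unary.Any using (here; there)
open import Data.List.Relation.Unary.Unique.Propositional using (Unique)
import Data.List.Relation.Unary.Unique.Propositional.Properties as Unique
open import Data.Maybe using (just)
open import Data.Nat using (ℕ; zero; suc; _+_; _∸_; _≤_; _<_; z≤n; s≤s; _⊓_; _≟_)
open import Data.Nat.Properties
open import Data.Product using (_×_; _,_; ∃-syntax; proj₁; proj₂)
open import Data.Sum using (_⊎_; inj₁; inj₂)
open import Function.Base using (id; _∘_)
open import Function.Bundles using (_⇔_; Equivalence; mk⇔)
open import Relation.Binary.PropositionalEquality
open import Relation.Nullary using (yes; no)

module _ {A : Set} where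

  take-++ˡ : ∀ j (as bs : List A) → j ≤ length as → take j (as ++ bs) ≡ take j as
  take-++ˡ zero as bs _ = refl
  take-++ˡ (suc j) (a ∷ as) bs (s≤s j≤) = cong (a ∷_) (take-++ˡ j as bs j≤)

  drop-++ˡ : ∀ j (as bs : List A) → j ≤ length as → drop j (as ++ bs) ≡ drop j as ++ bs
  drop-++ˡ zero as bs _ = refl
  drop-++ˡ (suc j) (a ∷ as) bs (s≤s j≤) = drop-++ˡ j as bs j≤

  take-suc-drop : ∀ j (xs : List A) {x ys} → drop j xs ≡ x ∷ ys → take (suc j) xs ≡ take j xs ∷ʳ x
  take-suc-drop zero (y ∷ xs) refl = refl
  take-suc-drop (suc j) (y ∷ xs) e = cong (y ∷_) (take-suc-drop j xs e)

  ++-cancel-≡length : ∀ (p q s t : List A) → length p ≡ length q → p ++ s ≡ q ++ t → p ≡ q × s ≡ t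
  ++-cancel-≡length [] [] s t _ e = refl , e
  ++-cancel-≡length (a ∷ p) (b ∷ q) s t len e with ∷-injective e
  ... | refl , e′ with ++-cancel-≡length p q s t (suc-injective len) e′
  ...   | refl , e″ = refl , e″

  length-∷ʳ : ∀ (as : List A) a → length (as ∷ʳ a) ≡ suc (length as)
  length-∷ʳ as a = trans (length-++ as) (+-comm (length as) 1)

  length-init : ∀ (as : List A) a {k} → length (as ∷ʳ a) ≡ suc k → length as ≡ k
  length-init as a len = suc-injective (trans (sym (length-∷ʳ as a)) len)

  last-∷ʳ : ∀ (as : List A) a → last (as ∷ʳ a) ≡ just a
  last-∷ʳ [] a = refl
  last-∷ʳ (b ∷ []) a = refl
  last-∷ʳ (b ∷ c ∷ as) a = last-∷ʳ (c ∷ as) a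

  last-∈ : ∀ (a : List A) {c} → last a ≡ just c → c ∈ a
  last-∈ a e with initLast a
  last-∈ a () | []
  ... | p ∷ʳ′ c′ with trans (sym (last-∷ʳ p c′)) e
  ...   | refl = ∈-++⁺ʳ p (here refl)

  Unique-resp-↭ : ∀ {xs ys : List A} → xs ↭ ys → Unique xs → Unique ys
  Unique-resp-↭ p = ↭ₛ.Unique-resp-↭ (setoid A) (↭⇒↭ₛ p)

σ-↭ : ∀ r a → σ r a ↭ a
σ-↭ r [] = ↭-refl
σ-↭ r (a ∷ as) = ↭-trans (↭.shift a (take (r ∸ 1) as) (drop (r ∸ 1) as))
  (prep a (↭-reflexive (take++drop≡id (r ∸ 1) as)))

length-σ : ∀ r a → length (σ r a) ≡ length a
length-σ r a = ↭.↭-length (σ-↭ r a)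

σ-map : ∀ (f : ℕ → ℕ) r a → σ r (map f a) ≡ map f (σ r a)
σ-map f r [] = refl
σ-map f r (a ∷ as) rewrite take-map {f = f} (r ∸ 1) as | drop-map {f = f} (r ∸ 1) as =
  sym (map-++ f (take (r ∸ 1) as) (a ∷ drop (r ∸ 1) as))

σ-∷ʳ : ∀ r (a : List ℕ) c → r ≤ length a → σ r (a ∷ʳ c) ≡ σ r a ∷ʳ c
σ-∷ʳ zero [] c _ = refl
σ-∷ʳ r (a ∷ as) c r≤
  rewrite take-++ˡ (r ∸ 1) as (c ∷ []) (∸-monoˡ-≤ 1 r≤)
        | drop-++ˡ (r ∸ 1) as (c ∷ []) (∸-monoˡ-≤ 1 r≤)
  = sym (++-assoc (take (r ∸ 1) as) (a ∷ drop (r ∸ 1) as) (c ∷ []))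

σ-rotate : ∀ r a (as : List ℕ) → length as ≡ r ∸ 1 → σ r (a ∷ as) ≡ as ∷ʳ a
σ-rotate r a as len
  rewrite take-all (r ∸ 1) as (≤-reflexive len) | drop-all (r ∸ 1) as (≤-reflexive len) = refl

σ-injective : ∀ r (a b : List ℕ) → length a ≡ length b → σ r a ≡ σ r b → a ≡ b
σ-injective r [] [] _ _ = refl
σ-injective r (a ∷ as) (b ∷ bs) len e
  with ++-cancel-≡length (take (r ∸ 1) as) (take (r ∸ 1) bs) _ _ equal-takes e
  where
  equal-takes : length (take (r ∸ 1) as) ≡ length (take (r ∸ 1) bs)
  equal-takes = begin
    length (take (r ∸ 1) as) ≡⟨ length-take (r ∸ 1) as ⟩
    (r ∸ 1) ⊓ length as      ≡⟨ cong ((r ∸ 1) ⊓_) (suc-injective len) ⟩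
    (r ∸ 1) ⊓ length bs      ≡⟨ length-take (r ∸ 1) bs ⟨
    length (take (r ∸ 1) bs) ∎
    where open ≡-Reasoning
... | takes , e′ with ∷-injective e′
...   | refl , drops = cong (a ∷_) (begin
  as                                    ≡⟨ take++drop≡id (r ∸ 1) as ⟨
  take (r ∸ 1) as ++ drop (r ∸ 1) as    ≡⟨ cong₂ _++_ takes drops ⟩
  take (r ∸ 1) bs ++ drop (r ∸ 1) bs    ≡⟨ take++drop≡id (r ∸ 1) bs ⟩
  bs                                    ∎)
  where open ≡-Reasoning

σ-rotate-init : ∀ r a (as : List ℕ) b → length as ≡ r → σ (suc r) ((a ∷ as) ∷ʳ b) ≡ (as ∷ʳ a) ∷ʳ b
σ-rotate-init r a as b len =
  trans (σ-∷ʳ (suc r) (a ∷ as) b (s≤s (≤-reflexive (sym len)))) (cong (_∷ʳ b) (σ-rotate (suc r) a as len))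

σ-rotate-all : ∀ r a (as : List ℕ) b → length as ≡ r → σ (suc (suc r)) ((a ∷ as) ∷ʳ b) ≡ (as ∷ʳ b) ∷ʳ a
σ-rotate-all r a as b len = σ-rotate (suc (suc r)) a (as ∷ʳ b) (trans (length-∷ʳ as b) (cong suc len))

-- Writing a string of length k + 1 as a w b, σₖ gives w a b and σₖ₊₁ gives w b a.
σ-exchange : ∀ k (X Z : List ℕ) → 1 ≤ k → length X ≡ suc k → length Z ≡ suc k →
  σ k Z ≡ σ (suc k) X → σ (suc k) Z ≡ σ k X
σ-exchange (suc k) (c ∷ xs) (a ∷ zs) _ lenX lenZ e with initLast xs | initLast zs
... | cs ∷ʳ′ d | as ∷ʳ′ b = exchange (length-init cs d (suc-injective lenX)) (length-init as b (suc-injective lenZ))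
  where
  exchange : length cs ≡ k → length as ≡ k → σ (suc (suc k)) ((a ∷ as) ∷ʳ b) ≡ σ (suc k) ((c ∷ cs) ∷ʳ d)
  exchange lenCs lenAs
    with ∷ʳ-injective (as ∷ʳ a) (cs ∷ʳ d)
           (trans (sym (σ-rotate-init k a as b lenAs)) (trans e (σ-rotate-all k c cs d lenCs)))
  ... | e′ , refl with ∷ʳ-injective as cs e′
  ...   | refl , refl = trans (σ-rotate-all k a as b lenAs) (sym (σ-rotate-init k c cs d lenCs))

Walk : List ℕ → List ℕ → List (List ℕ) → List ℕ → Set
Walk v S L w = visited v S ≡ L × final v S ≡ w

walk-step : ∀ r v → Walk v (r ∷ []) (v ∷ []) (σ r v)
walk-step r v = refl , refl

walk-++ : ∀ {u v w A CopyAt L L′} → Walk u A L v → Walk v CopyAt L′ w → Walk u (A ++ CopyAt) (L ++ L′) w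
walk-++ {u} {A = A} {CopyAt} (refl , refl) (refl , refl) = visited-++ u A , foldl-++ (λ w r → σ r w) u A CopyAt
  where
  visited-++ : ∀ v A → visited v (A ++ CopyAt) ≡ visited v A ++ visited (final v A) CopyAt
  visited-++ v [] = refl
  visited-++ v (r ∷ A) = cong (v ∷_) (visited-++ (σ r v) A)

walk-≡ : ∀ {v S L L′ w w′} → Walk v S L w → L ≡ L′ → w ≡ w′ → Walk v S L′ w′
walk-≡ (p , q) refl refl = p , q

walk-map : ∀ (F : List ℕ → List ℕ) → (∀ {r} q → r ≤ length q → σ r (F q) ≡ F (σ r q)) →
  ∀ {v S L w} → All (_≤ length v) S → Walk v S L w → Walk (F v) S (map F L) (F w)
walk-map F F-σ {v} {S} S≤ (refl , refl) = visited-F v S S≤ , final-F v S S≤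
  where
  bounded-σ : ∀ r v {S} → All (_≤ length v) S → All (_≤ length (σ r v)) S
  bounded-σ r v = subst (λ l → All (_≤ l) _) (sym (length-σ r v))

  visited-F : ∀ v S → All (_≤ length v) S → visited (F v) S ≡ map F (visited v S)
  visited-F v [] _ = refl
  visited-F v (r ∷ S) (r≤ ∷ S≤) rewrite F-σ v r≤ =
    cong (F v ∷_) (visited-F (σ r v) S (bounded-σ r v S≤))

  final-F : ∀ v S → All (_≤ length v) S → final (F v) S ≡ F (final v S)
  final-F v [] _ = refl
  final-F v (r ∷ S) (r≤ ∷ S≤) rewrite F-σ v r≤ = final-F (σ r v) S (bounded-σ r v S≤)

visited-↭ : ∀ {a} v S → a ∈ visited v S → a ↭ v
visited-↭ v (r ∷ S) (here refl) = ↭-refl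
visited-↭ v (r ∷ S) (there a∈) = ↭-trans (visited-↭ (σ r v) S a∈) (σ-↭ r v)

descending : ℕ → List ℕ
descending = applyDownFrom suc

startString≡descending : ∀ n → startString n ≡ descending n
startString≡descending n = reverse-applyUpTo suc n

ascending↭descending : ∀ n → ascending n ↭ descending n
ascending↭descending n =
  ↭-trans (↭-sym (↭.↭-reverse (ascending n))) (↭-reflexive (startString≡descending n))

length-descending : ∀ n → length (descending n) ≡ n
length-descending = length-applyDownFrom suc

Unique-descending : ∀ n → Unique (descending n)
Unique-descending n = Unique.applyDownFrom⁺₁ suc n (λ j<i _ e → <⇒≢ j<i (sym (suc-injective e)))

∈-descending : ∀ {i} n → i ∈ descending n → 1 ≤ i × i ≤ n
∈-descending (suc n) (here refl) = s≤s z≤n , ≤-refl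
∈-descending (suc n) (there i∈) with ∈-descending n i∈
... | 1≤i , i≤n = 1≤i , m≤n⇒m≤1+n i≤n

last-bounded : ∀ {k a} → 1 ≤ k → a ↭ descending k → ∃[ c ] last a ≡ just c × c ≤ k
last-bounded {k} {a} 1≤k a↭ with initLast a
... | [] = ⊥-elim (<⇒≢ 1≤k (trans (↭.↭-length a↭) (length-descending k)))
... | p ∷ʳ′ c = c , last-∷ʳ p c , proj₂ (∈-descending k (↭.∈-resp-↭ a↭ (∈-++⁺ʳ p (here refl))))

drop-descending : ∀ n j → j < n → drop j (descending n) ≡ n ∸ j ∷ drop (suc j) (descending n)
drop-descending (suc n) zero _ = refl
drop-descending (suc n) (suc j) (s≤s j<n) = drop-descending n j j<n

-- For 1 ≤ c ≤ n, rotDesc n c is the rotation (c-1)⋯1 n⋯c of n⋯1 ending in c.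
rotDesc : ℕ → ℕ → List ℕ
rotDesc n c = drop (suc (n ∸ c)) (descending n) ++ take (suc (n ∸ c)) (descending n)

rotDescInit : ℕ → ℕ → List ℕ
rotDescInit n c = drop (suc (n ∸ c)) (descending n) ++ take (n ∸ c) (descending n)

rotDesc-↭ : ∀ n c → rotDesc n c ↭ descending n
rotDesc-↭ n c = ↭-trans (↭.++-comm (drop (suc (n ∸ c)) (descending n)) _)
  (↭-reflexive (take++drop≡id (suc (n ∸ c)) (descending n)))

length-rotDesc : ∀ n c → length (rotDesc n c) ≡ n
length-rotDesc n c = trans (↭.↭-length (rotDesc-↭ n c)) (length-descending n)

rotDesc-1 : ∀ k → rotDesc (suc k) 1 ≡ descending (suc k)
rotDesc-1 k rewrite drop-all (suc k) (descending (suc k)) (≤-reflexive (length-descending (suc k)))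
  = take-all (suc k) (descending (suc k)) (≤-reflexive (length-descending (suc k)))

∸-suc : ∀ n c → c < n → n ∸ c ≡ suc (n ∸ suc c)
∸-suc (suc n) c (s≤s c≤n) = +-∸-assoc 1 c≤n

drop-descending-∸ : ∀ n c → 1 ≤ c → c ≤ n →
  drop (n ∸ c) (descending n) ≡ c ∷ drop (suc (n ∸ c)) (descending n)
drop-descending-∸ n c 1≤c c≤n =
  trans (drop-descending n (n ∸ c) (∸-monoʳ-< 1≤c c≤n)) (cong (_∷ drop (suc (n ∸ c)) (descending n)) (m∸[m∸n]≡n c≤n))

rotDesc-∷ʳ : ∀ n c → 1 ≤ c → c ≤ n → rotDesc n c ≡ rotDescInit n c ∷ʳ c
rotDesc-∷ʳ n c 1≤c c≤n = begin
  drop j′ dn ++ take j′ dn              ≡⟨ cong (drop j′ dn ++_) (take-suc-drop (n ∸ c) dn (drop-descending-∸ n c 1≤c c≤n)) ⟩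
  drop j′ dn ++ (take (n ∸ c) dn ∷ʳ c)  ≡⟨ ++-assoc (drop j′ dn) (take (n ∸ c) dn) (c ∷ []) ⟨
  rotDescInit n c ∷ʳ c                  ∎
  where
  open ≡-Reasoning
  dn = descending n
  j′ = suc (n ∸ c)

rotDesc-suc : ∀ n c → 1 ≤ c → c < n → rotDesc n (suc c) ≡ c ∷ rotDescInit n c
rotDesc-suc n c 1≤c c<n = begin
  rotDesc n (suc c)                   ≡⟨ cong (λ j → drop j dn ++ take j dn) (∸-suc n c c<n) ⟨
  drop (n ∸ c) dn ++ take (n ∸ c) dn  ≡⟨ cong (_++ take (n ∸ c) dn) (drop-descending-∸ n c 1≤c (<⇒≤ c<n)) ⟩
  c ∷ rotDescInit n c                 ∎
  where
  open ≡-Reasoning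
  dn = descending n

length-rotDescInit : ∀ n c → 1 ≤ c → c ≤ n → length (rotDescInit n c) ≡ n ∸ 1
length-rotDescInit n c 1≤c c≤n = cong (_∸ 1) (begin
  suc (length (rotDescInit n c)) ≡⟨ length-∷ʳ (rotDescInit n c) c ⟨
  length (rotDescInit n c ∷ʳ c)  ≡⟨ cong length (rotDesc-∷ʳ n c 1≤c c≤n) ⟨
  length (rotDesc n c)           ≡⟨ length-rotDesc n c ⟩
  n                              ∎)
  where open ≡-Reasoning

σ-rotDesc : ∀ n c → 1 ≤ c → c < n → σ n (rotDesc n (suc c)) ≡ rotDesc n c
σ-rotDesc n c 1≤c c<n = begin
  σ n (rotDesc n (suc c))      ≡⟨ cong (σ n) (rotDesc-suc n c 1≤c c<n) ⟩
  σ n (c ∷ rotDescInit n c)    ≡⟨ σ-rotate n c (rotDescInit n c) (length-rotDescInit n c 1≤c (<⇒≤ c<n)) ⟩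
  rotDescInit n c ∷ʳ c         ≡⟨ rotDesc-∷ʳ n c 1≤c (<⇒≤ c<n) ⟨
  rotDesc n c                  ∎
  where open ≡-Reasoning

-- relabel P and unlabel P are inverse bijections between descending (length P) and P, entry by entry.
relabel : List ℕ → ℕ → ℕ
relabel [] i = 0
relabel (a ∷ P) i with i ≟ suc (length P)
... | yes _ = a
... | no _ = relabel P i

unlabel : List ℕ → ℕ → ℕ
unlabel [] b = 0
unlabel (a ∷ P) b with b ≟ a
... | yes _ = suc (length P)
... | no _ = unlabel P b

relabel-∷ : ∀ a P i → i ∈ descending (length P) → relabel (a ∷ P) i ≡ relabel P i
relabel-∷ a P i i∈ with i ≟ suc (length P)
... | yes refl = ⊥-elim (1+n≰n (proj₂ (∈-descending (length P) i∈)))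
... | no _ = refl

map-relabel-descending : ∀ P → map (relabel P) (descending (length P)) ≡ P
map-relabel-descending [] = refl
map-relabel-descending (a ∷ P) with suc (length P) ≟ suc (length P)
... | no ≢ = ⊥-elim (≢ refl)
... | yes _ = cong (a ∷_)
  (trans (map-cong-local (All.tabulate (relabel-∷ a P _))) (map-relabel-descending P))

relabel-∈ : ∀ P i → i ∈ descending (length P) → relabel P i ∈ P
relabel-∈ (a ∷ P) i i∈ with i ≟ suc (length P)
relabel-∈ (a ∷ P) i i∈          | yes _ = here refl
relabel-∈ (a ∷ P) i (here i≡)   | no i≢ = ⊥-elim (i≢ i≡)
relabel-∈ (a ∷ P) i (there i∈)  | no _ = there (relabel-∈ P i i∈)

unlabel-∈ : ∀ P b → b ∈ P → unlabel P b ∈ descending (length P)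
unlabel-∈ (a ∷ P) b b∈ with b ≟ a
unlabel-∈ (a ∷ P) b b∈          | yes _ = here refl
unlabel-∈ (a ∷ P) b (here b≡)   | no b≢ = ⊥-elim (b≢ b≡)
unlabel-∈ (a ∷ P) b (there b∈)  | no _ = there (unlabel-∈ P b b∈)

unlabel-relabel : ∀ P i → Unique P → i ∈ descending (length P) → unlabel P (relabel P i) ≡ i
unlabel-relabel (a ∷ P) i (a∉P ∷ !P) i∈ with i ≟ suc (length P)
unlabel-relabel (a ∷ P) i (a∉P ∷ !P) i∈ | yes i≡ with a ≟ a
... | yes _ = sym i≡
... | no ≢ = ⊥-elim (≢ refl)
unlabel-relabel (a ∷ P) i (a∉P ∷ !P) (here i≡) | no i≢ = ⊥-elim (i≢ i≡)
unlabel-relabel (a ∷ P) i (a∉P ∷ !P) (there i∈) | no _ with relabel P i ≟ a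
... | yes ≡a = ⊥-elim (All.lookup a∉P (relabel-∈ P i i∈) (sym ≡a))
... | no _ = unlabel-relabel P i !P i∈

relabel-unlabel : ∀ P b → b ∈ P → relabel P (unlabel P b) ≡ b
relabel-unlabel (a ∷ P) b b∈ with b ≟ a
relabel-unlabel (a ∷ P) b b∈ | yes b≡ with suc (length P) ≟ suc (length P)
... | yes _ = sym b≡
... | no ≢ = ⊥-elim (≢ refl)
relabel-unlabel (a ∷ P) b (here b≡) | no b≢ = ⊥-elim (b≢ b≡)
relabel-unlabel (a ∷ P) b (there b∈) | no _ =
  trans (relabel-∷ a P (unlabel P b) (unlabel-∈ P b b∈)) (relabel-unlabel P b b∈)

relabelled : List ℕ → ℕ → List ℕ → List ℕ
relabelled P c q = map (relabel P) q ∷ʳ c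

module CycleCopies
  (k : ℕ) (1≤k : 1 ≤ k) (R : ℕ → Set) (T : List ℕ) (T≤k : All (_≤ k) T)
  (ham : IsHamiltonSeq k R k (T ++ k ∷ k ∷ []))
  where

  n : ℕ
  n = suc k

  W : List (List ℕ)
  W = visited (descending k) T

  x : List ℕ
  x = final (descending k) T

  y : List ℕ
  y = σ k x

  C : List (List ℕ)
  C = W ++ x ∷ y ∷ []

  walk-T : Walk (descending k) T W x
  walk-T = refl , refl

  cycle-walk : Walk (descending k) (T ++ k ∷ k ∷ []) C (σ k y)
  cycle-walk = walk-++ walk-T (walk-++ (walk-step k x) (walk-step k y))

  visited-cycle : visited (startString k) (T ++ k ∷ k ∷ []) ≡ C
  visited-cycle = trans (cong (λ v → visited v (T ++ k ∷ k ∷ [])) (startString≡descending k)) (proj₁ cycle-walk)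

  cycle-unique : Unique C
  cycle-unique = subst Unique visited-cycle (proj₁ (proj₂ ham))

  cycle-complete : ∀ q → (q ∈ C) ⇔ (q ↭ descending k)
  cycle-complete q = mk⇔
    (λ q∈ → ↭-trans (proj₁ (Equivalence.to (complete q) (subst (q ∈_) (sym visited-cycle) q∈))) (ascending↭descending k))
    (λ q↭ → subst (q ∈_) visited-cycle
      (Equivalence.from (complete q) (↭-trans q↭ (↭-sym (ascending↭descending k)) , last-bounded 1≤k q↭)))
    where complete = proj₁ (proj₂ (proj₂ ham))

  cycle-closed : σ k y ≡ descending k
  cycle-closed = begin
    σ k y                                    ≡⟨ proj₂ cycle-walk ⟨
    final (descending k) (T ++ k ∷ k ∷ [])   ≡⟨ cong (λ v → final v (T ++ k ∷ k ∷ [])) (startString≡descending k) ⟨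
    final (startString k) (T ++ k ∷ k ∷ [])  ≡⟨ proj₂ (proj₂ (proj₂ ham)) ⟩
    startString k                            ≡⟨ startString≡descending k ⟩
    descending k                             ∎
    where open ≡-Reasoning

  C-↭ : ∀ {q} → q ∈ C → q ↭ descending k
  C-↭ {q} = Equivalence.to (cycle-complete q)

  length-C : ∀ {q} → q ∈ C → length q ≡ k
  length-C q∈ = trans (↭.↭-length (C-↭ q∈)) (length-descending k)

  x∈C : x ∈ C
  x∈C = ∈-++⁺ʳ W (here refl)

  y∈C : y ∈ C
  y∈C = ∈-++⁺ʳ W (there (here refl))

  module Copy (P : List ℕ) (c : ℕ) (P∷ʳc↭ : P ∷ʳ c ↭ descending n) where

    image : List ℕ → List ℕ
    image = relabelled P c

    c∷P-unique : Unique (c ∷ P)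
    c∷P-unique = Unique-resp-↭ (↭-sym (↭-trans (↭.∷↭∷ʳ c P) P∷ʳc↭)) (Unique-descending n)

    P-unique : Unique P
    P-unique with c∷P-unique
    ... | _ ∷ !P = !P

    length-P : length P ≡ k
    length-P = length-init P c (trans (↭.↭-length P∷ʳc↭) (length-descending n))

    relabel-descending : map (relabel P) (descending k) ≡ P
    relabel-descending = subst (λ l → map (relabel P) (descending l) ≡ P) length-P (map-relabel-descending P)

    unlabel-relabel-descending : ∀ {q} → All (_∈ descending k) q → map (unlabel P) (map (relabel P) q) ≡ q
    unlabel-relabel-descending {q} q⊆ = trans (sym (map-∘ q)) (map-id-local (All.map
      (λ {i} i∈ → unlabel-relabel P i P-unique (subst (λ l → i ∈ descending l) (sym length-P) i∈)) q⊆))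

    image-σ : ∀ {r} q → r ≤ length q → σ r (image q) ≡ image (σ r q)
    image-σ {r} q r≤ = trans (σ-∷ʳ r (map (relabel P) q) c (subst (r ≤_) (sym (length-map _ q)) r≤))
      (cong (_∷ʳ c) (σ-map (relabel P) r q))

    image-descending : image (descending k) ≡ P ∷ʳ c
    image-descending = cong (_∷ʳ c) relabel-descending

    walk-image-T : Walk (P ∷ʳ c) T (map image W) (image x)
    walk-image-T = subst (λ v → Walk v T (map image W) (image x)) image-descending
      (walk-map image image-σ (subst (λ l → All (_≤ l) T) (sym (length-descending k)) T≤k) walk-T)

    σ-image-x : σ k (image x) ≡ image y
    σ-image-x = image-σ x (≤-reflexive (sym (length-C x∈C)))

    σ-image-y : σ k (image y) ≡ P ∷ʳ c
    σ-image-y = trans (image-σ y (≤-reflexive (sym (length-C y∈C))))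
      (trans (cong image cycle-closed) image-descending)

    length-image : ∀ {q} → q ∈ C → length (image q) ≡ n
    length-image {q} q∈ = trans (length-∷ʳ (map (relabel P) q) c) (cong suc (trans (length-map _ q) (length-C q∈)))

    image-unique : Unique (map image C)
    image-unique = subst Unique (sym (map-∘ C))
      (Unique.map⁺ (λ {a} {b} → ∷ʳ-injectiveˡ a b) (Unique.map⁻ (subst Unique (sym unlabelled) cycle-unique)))
      where
      entries : ∀ {q} → q ∈ C → All (_∈ descending k) q
      entries q∈ = ↭.All-resp-↭ (↭-sym (C-↭ q∈)) (All.tabulate id)
      unlabelled : map (map (unlabel P)) (map (map (relabel P)) C) ≡ C
      unlabelled = trans (sym (map-∘ C))
        (map-id-local (All.tabulate (λ q∈ → unlabel-relabel-descending (entries q∈))))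

    image-covers : ∀ a → a ↭ descending n → last a ≡ just c → a ∈ map image C
    image-covers a a↭ e with initLast a
    image-covers a a↭ () | []
    ... | p ∷ʳ′ c′ with trans (sym (last-∷ʳ p c′)) e
    ...   | refl = subst (_∈ map image C) (cong (_∷ʳ c) relabel-unlabel-p) (∈-map⁺ image q∈C)
      where
      p↭P : p ↭ P
      p↭P = ↭.drop-∷ (↭-trans (↭.∷↭∷ʳ c p) (↭-trans a↭ (↭-sym (↭-trans (↭.∷↭∷ʳ c P) P∷ʳc↭))))
      q = map (unlabel P) p
      q↭ : q ↭ descending k
      q↭ = ↭-trans (↭.map⁺ (unlabel P) p↭P) (↭-reflexive (begin
        map (unlabel P) P                                     ≡⟨ cong (map (unlabel P)) relabel-descending ⟨
        map (unlabel P) (map (relabel P) (descending k))      ≡⟨ unlabel-relabel-descending (All.tabulate id) ⟩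
        descending k                                          ∎))
        where open ≡-Reasoning
      q∈C : q ∈ C
      q∈C = Equivalence.from (cycle-complete q) q↭
      relabel-unlabel-p : map (relabel P) q ≡ p
      relabel-unlabel-p = trans (sym (map-∘ p))
        (map-id-local (All.map (relabel-unlabel P _) (↭.All-resp-↭ (↭-sym p↭P) (All.tabulate id))))

  -- Copy c of the cycle is entered at n⋯1 for c = 1 and at σₖ (rotDesc n c) for c ≥ 2.
  prefix : ℕ → List ℕ
  prefix (suc zero) = rotDescInit n 1
  prefix c = σ k (rotDescInit n c)

  prefix-1 : prefix 1 ∷ʳ 1 ≡ descending n
  prefix-1 = trans (sym (rotDesc-∷ʳ n 1 ≤-refl (s≤s z≤n))) (rotDesc-1 k)

  prefix-∷ʳ : ∀ c → 2 ≤ c → c ≤ n → prefix c ∷ʳ c ≡ σ k (rotDesc n c)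
  prefix-∷ʳ (suc zero) (s≤s ()) _
  prefix-∷ʳ c@(suc (suc _)) _ c≤n = begin
    σ k (rotDescInit n c) ∷ʳ c    ≡⟨ σ-∷ʳ k (rotDescInit n c) c (≤-reflexive (sym (length-rotDescInit n c (s≤s z≤n) c≤n))) ⟨
    σ k (rotDescInit n c ∷ʳ c)    ≡⟨ cong (σ k) (rotDesc-∷ʳ n c (s≤s z≤n) c≤n) ⟨
    σ k (rotDesc n c)             ∎
    where open ≡-Reasoning

  prefix-↭ : ∀ c → 1 ≤ c → c ≤ n → prefix c ∷ʳ c ↭ descending n
  prefix-↭ (suc zero) _ _ = ↭-reflexive prefix-1
  prefix-↭ c@(suc (suc _)) _ c≤n = ↭-trans (↭-reflexive (prefix-∷ʳ c (s≤s (s≤s z≤n)) c≤n))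
    (↭-trans (σ-↭ k (rotDesc n c)) (rotDesc-↭ n c))

  copy : ℕ → List ℕ → List ℕ
  copy c = relabelled (prefix c) c

  module CopyAt (c : ℕ) (1≤c : 1 ≤ c) (c≤n : c ≤ n) = Copy (prefix c) c (prefix-↭ c 1≤c c≤n)

  copy-y : ∀ c → 2 ≤ c → c ≤ n → copy c y ≡ rotDesc n c
  copy-y c 2≤c c≤n = σ-injective k (copy c y) (rotDesc n c)
    (trans (CopyAt.length-image c 1≤c c≤n y∈C) (sym (length-rotDesc n c)))
    (trans (CopyAt.σ-image-y c 1≤c c≤n) (prefix-∷ʳ c 2≤c c≤n))
    where 1≤c = ≤-trans (s≤s z≤n) 2≤c

  exit-first : σ n (copy 1 y) ≡ σ k (rotDesc n 2)
  exit-first = σ-exchange k (rotDesc n 2) (copy 1 y) 1≤k (length-rotDesc n 2)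
    (CopyAt.length-image 1 ≤-refl (s≤s z≤n) y∈C) (begin
      σ k (copy 1 y)     ≡⟨ CopyAt.σ-image-y 1 ≤-refl (s≤s z≤n) ⟩
      prefix 1 ∷ʳ 1      ≡⟨ prefix-1 ⟩
      descending n       ≡⟨ rotDesc-1 k ⟨
      rotDesc n 1        ≡⟨ σ-rotDesc n 1 ≤-refl (s≤s 1≤k) ⟨
      σ n (rotDesc n 2)  ∎)
    where open ≡-Reasoning

  exit-middle : ∀ c → 2 ≤ c → c < n → σ n (copy c x) ≡ σ k (rotDesc n (suc c))
  exit-middle c 2≤c c<n = σ-exchange k (rotDesc n (suc c)) (copy c x) 1≤k (length-rotDesc n (suc c))
    (CopyAt.length-image c 1≤c (<⇒≤ c<n) x∈C) (begin
      σ k (copy c x)           ≡⟨ CopyAt.σ-image-x c 1≤c (<⇒≤ c<n) ⟩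
      copy c y                 ≡⟨ copy-y c 2≤c (<⇒≤ c<n) ⟩
      rotDesc n c              ≡⟨ σ-rotDesc n c 1≤c c<n ⟨
      σ n (rotDesc n (suc c))  ∎)
    where
    open ≡-Reasoning
    1≤c = ≤-trans (s≤s z≤n) 2≤c

  exit-last : ∀ c → 1 ≤ c → c < n → σ n (copy (suc c) y) ≡ rotDesc n c
  exit-last c 1≤c c<n = trans (cong (σ n) (copy-y (suc c) (s≤s 1≤c) c<n)) (σ-rotDesc n c 1≤c c<n)

  walk-copy : ∀ c → 1 ≤ c → c ≤ n →
    Walk (prefix c ∷ʳ c) (T ++ k ∷ n ∷ []) (map (copy c) C) (σ n (copy c y))
  walk-copy c 1≤c c≤n =
    walk-≡ (walk-++ (CopyAt.walk-image-T c 1≤c c≤n) (walk-++ (walk-step k _) (walk-step n _)))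
      (trans (cong (λ z → map (copy c) W ++ copy c x ∷ z ∷ []) (CopyAt.σ-image-x c 1≤c c≤n))
        (sym (map-++ (copy c) W (x ∷ y ∷ []))))
      (cong (σ n) (CopyAt.σ-image-x c 1≤c c≤n))

  walk-partialCopy : ∀ c → 2 ≤ c → c ≤ n →
    Walk (σ k (rotDesc n c)) (T ++ n ∷ []) (map (copy c) W ++ copy c x ∷ []) (σ n (copy c x))
  walk-partialCopy c 2≤c c≤n =
    subst (λ v → Walk v (T ++ n ∷ []) (map (copy c) W ++ copy c x ∷ []) (σ n (copy c x)))
      (prefix-∷ʳ c 2≤c c≤n) (walk-++ (CopyAt.walk-image-T c (≤-trans (s≤s z≤n) 2≤c) c≤n) (walk-step n _))

  partialCopies : ℕ → ℕ → List (List ℕ)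
  partialCopies c zero = []
  partialCopies c (suc j) = (map (copy c) W ++ copy c x ∷ []) ++ partialCopies (suc c) j

  walk-partialCopies : ∀ j c → 2 ≤ c → c + j ≤ n →
    Walk (σ k (rotDesc n c)) (concat (replicate j (T ++ n ∷ []))) (partialCopies c j) (σ k (rotDesc n (c + j)))
  walk-partialCopies zero c _ _ = refl , cong (σ k ∘ rotDesc n) (sym (+-identityʳ c))
  walk-partialCopies (suc j) c 2≤c c+j<n = walk-++
    (walk-≡ (walk-partialCopy c 2≤c (<⇒≤ c<n)) refl (exit-middle c 2≤c c<n))
    (walk-≡ (walk-partialCopies j (suc c) (m≤n⇒m≤1+n 2≤c) (subst (_≤ n) (+-suc c j) c+j<n))
      refl (cong (σ k ∘ rotDesc n) (sym (+-suc c j))))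
    where
    c<n : c < n
    c<n = ≤-trans (m<m+n c (s≤s z≤n)) c+j<n

  trail : ℕ → ℕ → List (List ℕ)
  trail c zero = []
  trail c (suc j) = rotDesc n (c + suc j) ∷ trail c j

  walk-trail : ∀ j c → 1 ≤ c → c + j ≤ n → Walk (rotDesc n (c + j)) (replicate j n) (trail c j) (rotDesc n c)
  walk-trail zero c _ _ = refl , cong (rotDesc n) (+-identityʳ c)
  walk-trail (suc j) c 1≤c c+j<n = walk-++ (walk-≡ (walk-step n _) refl step)
    (walk-trail j c 1≤c (≤-trans (m≤n+m (c + j) 1) (subst (_≤ n) (+-suc c j) c+j<n)))
    where
    step : σ n (rotDesc n (c + suc j)) ≡ rotDesc n (c + j)
    step = trans (cong (σ n ∘ rotDesc n) (+-suc c j))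
      (σ-rotDesc n (c + j) (≤-trans 1≤c (m≤m+n c j)) (subst (_≤ n) (+-suc c j) c+j<n))

  rewindVisits : ℕ → List (List ℕ)
  rewindVisits m′ = map (copy 1) C ++ (partialCopies 2 m′ ++ (map (copy (2 + m′)) C ++ trail 1 m′))

  rewind-split : ∀ m′ → rewind n (2 + m′) T ≡
    (T ++ k ∷ n ∷ []) ++ (concat (replicate m′ (T ++ n ∷ [])) ++ ((T ++ k ∷ n ∷ []) ++ replicate m′ n))
  rewind-split m′ =
    trans (cong (λ z → T ++ k ∷ n ∷ concat (replicate m′ (T ++ n ∷ [])) ++ z) (sym (++-assoc T _ _)))
      (sym (++-assoc T (k ∷ n ∷ []) _))

  walk-rewind : ∀ m′ → 2 + m′ ≤ n → Walk (descending n) (rewind n (2 + m′) T) (rewindVisits m′) (descending n)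
  walk-rewind m′ M≤n = subst (λ S → Walk (descending n) S (rewindVisits m′) (descending n)) (sym (rewind-split m′))
    (walk-++ first-copy (walk-++ (walk-partialCopies m′ 2 ≤-refl M≤n) (walk-++ last-copy trail-home)))
    where
    M-1≤n : 1 + m′ ≤ n
    M-1≤n = ≤-trans (n≤1+n _) M≤n
    first-copy : Walk (descending n) (T ++ k ∷ n ∷ []) (map (copy 1) C) (σ k (rotDesc n 2))
    first-copy = walk-≡ (subst (λ v → Walk v (T ++ k ∷ n ∷ []) (map (copy 1) C) (σ n (copy 1 y))) prefix-1
      (walk-copy 1 ≤-refl (s≤s z≤n))) refl exit-first
    last-copy : Walk (σ k (rotDesc n (2 + m′))) (T ++ k ∷ n ∷ []) (map (copy (2 + m′)) C) (rotDesc n (1 + m′))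
    last-copy = walk-≡ (subst (λ v → Walk v (T ++ k ∷ n ∷ []) (map (copy (2 + m′)) C) (σ n (copy (2 + m′) y)))
      (prefix-∷ʳ (2 + m′) (s≤s (s≤s z≤n)) M≤n) (walk-copy (2 + m′) (s≤s z≤n) M≤n))
      refl (exit-last (1 + m′) (s≤s z≤n) M≤n)
    trail-home : Walk (rotDesc n (1 + m′)) (replicate m′ n) (trail 1 m′) (descending n)
    trail-home = walk-≡ (walk-trail m′ 1 ≤-refl M-1≤n) refl (rotDesc-1 k)

  copies : ℕ → ℕ → List (List ℕ)
  copies c zero = []
  copies c (suc j) = map (copy c) C ++ copies (suc c) j

  copies-∷ʳ : ∀ j c → copies c (suc j) ≡ copies c j ++ map (copy (c + j)) C
  copies-∷ʳ zero c = trans (++-identityʳ _) (cong (λ i → map (copy i) C) (sym (+-identityʳ c)))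
  copies-∷ʳ (suc j) c = trans (cong (map (copy c) C ++_) (copies-∷ʳ j (suc c)))
    (trans (sym (++-assoc (map (copy c) C) _ _)) (cong (λ i → copies c (suc j) ++ map (copy i) C) (sym (+-suc c j))))

  trail-∷ʳ : ∀ c j → trail c (suc j) ≡ trail (suc c) j ∷ʳ rotDesc n (suc c)
  trail-∷ʳ c zero = cong (λ i → rotDesc n i ∷ []) (+-comm c 1)
  trail-∷ʳ c (suc j) = cong₂ _∷_ (cong (rotDesc n) (+-suc c (suc j))) (trail-∷ʳ c j)

  copy-split : ∀ c → 2 ≤ c → c ≤ n → ∀ L →
    (map (copy c) W ++ copy c x ∷ []) ++ rotDesc n c ∷ L ≡ map (copy c) C ++ L
  copy-split c 2≤c c≤n L = begin
    (map f W ++ f x ∷ []) ++ rotDesc n c ∷ L    ≡⟨ ++-assoc (map f W) (f x ∷ []) _ ⟩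
    map f W ++ f x ∷ rotDesc n c ∷ L            ≡⟨ cong (λ z → map f W ++ f x ∷ z ∷ L) (copy-y c 2≤c c≤n) ⟨
    map f W ++ f x ∷ f y ∷ L                    ≡⟨ ++-assoc (map f W) (f x ∷ f y ∷ []) L ⟨
    (map f W ++ f x ∷ f y ∷ []) ++ L            ≡⟨ cong (_++ L) (map-++ f W (x ∷ y ∷ [])) ⟨
    map f C ++ L                                ∎
    where
    open ≡-Reasoning
    f = copy c

  -- The trail visits rotDesc n c = copy c y (copy-y), the one string skipped by each partial copy.
  partialCopies-trail-↭ : ∀ j c → 1 ≤ c → c + j ≤ n → partialCopies (suc c) j ++ trail c j ↭ copies (suc c) j
  partialCopies-trail-↭ zero c _ _ = ↭-refl
  partialCopies-trail-↭ (suc j) c 1≤c c+j<n = begin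
    (A ++ M′) ++ trail c (suc j)  ≡⟨ cong ((A ++ M′) ++_) (trail-∷ʳ c j) ⟩
    (A ++ M′) ++ (Tr ∷ʳ D)        ≡⟨ ++-assoc A M′ (Tr ∷ʳ D) ⟩
    A ++ (M′ ++ (Tr ∷ʳ D))        ≡⟨ cong (A ++_) (++-assoc M′ Tr (D ∷ [])) ⟨
    A ++ ((M′ ++ Tr) ∷ʳ D)        ↭⟨ ↭.++⁺ˡ A (↭.∷↭∷ʳ D (M′ ++ Tr)) ⟨
    A ++ D ∷ (M′ ++ Tr)           ↭⟨ ↭.++⁺ˡ A (prep D (partialCopies-trail-↭ j (suc c) (s≤s z≤n) sc+j≤n)) ⟩
    A ++ D ∷ copies (2 + c) j     ≡⟨ copy-split (suc c) (s≤s 1≤c) (≤-trans (s≤s (m≤m+n c j)) sc+j≤n) _ ⟩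
    copies (suc c) (suc j)        ∎
    where
    open PermutationReasoning
    A = map (copy (suc c)) W ++ copy (suc c) x ∷ []
    M′ = partialCopies (2 + c) j
    Tr = trail (suc c) j
    D = rotDesc n (suc c)
    sc+j≤n : suc c + j ≤ n
    sc+j≤n = subst (_≤ n) (+-suc c j) c+j<n

  rewindVisits-↭ : ∀ m′ → 2 + m′ ≤ n → rewindVisits m′ ↭ copies 1 (2 + m′)
  rewindVisits-↭ m′ M≤n = ↭.++⁺ˡ (map (copy 1) C) (begin
    partialCopies 2 m′ ++ (map (copy M) C ++ trail 1 m′)  ↭⟨ ↭.shifts (partialCopies 2 m′) (map (copy M) C) ⟩
    map (copy M) C ++ (partialCopies 2 m′ ++ trail 1 m′)  ↭⟨ ↭.++⁺ˡ (map (copy M) C) (partialCopies-trail-↭ m′ 1 ≤-refl M-1≤n) ⟩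
    map (copy M) C ++ copies 2 m′                         ↭⟨ ↭.++-comm (map (copy M) C) (copies 2 m′) ⟩
    copies 2 m′ ++ map (copy M) C                         ≡⟨ copies-∷ʳ m′ 2 ⟨
    copies 2 (suc m′)                                     ∎)
    where
    open PermutationReasoning
    M = 2 + m′
    M-1≤n : 1 + m′ ≤ n
    M-1≤n = ≤-trans (n≤1+n _) M≤n

  last-copies : ∀ j c {a} → a ∈ copies c j → ∃[ c′ ] last a ≡ just c′ × c ≤ c′ × c′ < c + j
  last-copies (suc j) c a∈ with ∈-++⁻ (map (copy c) C) a∈
  ... | inj₁ a∈copy with ∈-map⁻ (copy c) a∈copy
  ...   | q , _ , refl = c , last-∷ʳ (map (relabel (prefix c)) q) c , ≤-refl , m<m+n c (s≤s z≤n)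
  last-copies (suc j) c a∈ | inj₂ a∈rest with last-copies j (suc c) a∈rest
  ... | c′ , e , c<c′ , c′<sc+j = c′ , e , <⇒≤ c<c′ , subst (c′ <_) (sym (+-suc c j)) c′<sc+j

  copies-unique : ∀ j c → 1 ≤ c → c + j ≤ suc n → Unique (copies c j)
  copies-unique zero c _ _ = []
  copies-unique (suc j) c 1≤c c+j≤ = Unique.++⁺ (CopyAt.image-unique c 1≤c c≤n)
    (copies-unique j (suc c) (s≤s z≤n) (subst (_≤ suc n) (+-suc c j) c+j≤)) disjoint
    where
    c≤n : c ≤ n
    c≤n = ≤-pred (≤-trans (m<m+n c (s≤s z≤n)) c+j≤)
    disjoint : Disjoint (map (copy c) C) (copies (suc c) j)
    disjoint (a∈copy , a∈rest) with last-copies 1 c (∈-++⁺ˡ a∈copy) | last-copies j (suc c) a∈rest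
    ... | c′ , e , _ , c′<c+1 | c″ , e′ , c<c″ , _ with trans (sym e) e′
    ...   | refl = <⇒≱ c<c″ (≤-pred (subst (c′ <_) (+-comm c 1) c′<c+1))

  copies-cover : ∀ j c {a c′} → 1 ≤ c → c + j ≤ suc n → a ↭ descending n → last a ≡ just c′ →
    c ≤ c′ → c′ < c + j → a ∈ copies c j
  copies-cover zero c _ _ _ _ c≤c′ c′<c+0 = ⊥-elim (<⇒≱ c′<c+0 (subst (_≤ _) (sym (+-identityʳ c)) c≤c′))
  copies-cover (suc j) c {c′ = c′} 1≤c c+j≤ a↭ e c≤c′ c′<c+j with m≤n⇒m<n∨m≡n c≤c′
  ... | inj₂ refl = ∈-++⁺ˡ (CopyAt.image-covers c 1≤c (≤-pred (≤-trans c′<c+j c+j≤)) _ a↭ e)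
  ... | inj₁ c<c′ = ∈-++⁺ʳ (map (copy c) C) (copies-cover j (suc c) (s≤s z≤n)
    (subst (_≤ suc n) (+-suc c j) c+j≤) a↭ e c<c′ (subst (c′ <_) (+-suc c j) c′<c+j))

  module Rewind (m′ : ℕ) (M≤n : 2 + m′ ≤ n) where

    M : ℕ
    M = 2 + m′

    walk : Walk (descending n) (rewind n M T) (rewindVisits m′) (descending n)
    walk = walk-rewind m′ M≤n

    visited⇒copies : ∀ {a} → a ∈ visited (descending n) (rewind n M T) → a ∈ copies 1 M
    visited⇒copies a∈ = ↭.∈-resp-↭ (rewindVisits-↭ m′ M≤n) (subst (_ ∈_) (proj₁ walk) a∈)

    unique : Unique (visited (descending n) (rewind n M T))
    unique = subst Unique (sym (proj₁ walk))
      (Unique-resp-↭ (↭-sym (rewindVisits-↭ m′ M≤n)) (copies-unique M 1 ≤-refl (s≤s M≤n)))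

    complete : ∀ a → (a ∈ visited (descending n) (rewind n M T)) ⇔ Node n M a
    complete a = mk⇔
      (λ a∈ → let (c , e , _ , c<1+M) = last-copies M 1 (visited⇒copies a∈) in
        ↭-trans (visited-↭ (descending n) (rewind n M T) a∈) (↭-sym (ascending↭descending n)) , c , e , ≤-pred c<1+M)
      (λ (a↭ , c , e , c≤M) → subst (a ∈_) (sym (proj₁ walk)) (↭.∈-resp-↭ (↭-sym (rewindVisits-↭ m′ M≤n))
        (copies-cover M 1 ≤-refl (s≤s M≤n) (a↭′ a↭) e (1≤last (a↭′ a↭) e) (s≤s c≤M))))
      where
      a↭′ : a ↭ ascending n → a ↭ descending n
      a↭′ a↭ = ↭-trans a↭ (ascending↭descending n)
      1≤last : ∀ {c} → a ↭ descending n → last a ≡ just c → 1 ≤ c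
      1≤last a↭ e = proj₁ (∈-descending n (↭.∈-resp-↭ a↭ (last-∈ a e)))

    closed : final (descending n) (rewind n M T) ≡ descending n
    closed = proj₂ walk

    hamiltonian : ∀ {R′ : ℕ → Set} → All R′ (rewind n M T) → IsHamiltonSeq n R′ M (rewind n M T)
    hamiltonian allR′ rewrite startString≡descending n = allR′ , unique , complete , closed

All-rewind : ∀ {P : ℕ → Set} n m T → P (n ∸ 1) → P n → All P T → All P (rewind n m T)
All-rewind n m T p₁ p₂ pT = All.++⁺ pT (p₁ ∷ p₂ ∷ All.++⁺ (All.concat⁺ (All.replicate⁺ (m ∸ 2) (All.++⁺ pT (p₂ ∷ []))))
  (All.++⁺ pT (p₁ ∷ p₂ ∷ All.replicate⁺ (m ∸ 2) p₂)))

theorem6 : (n : ℕ) → 3 ≤ n → (R : ℕ → Set)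
    → (∀ r → R r → 2 ≤ r × r ≤ n ∸ 1)
    → (T : List ℕ)
    → IsHamiltonSeq (n ∸ 1) R (n ∸ 1) (T ++ (n ∸ 1 ∷ n ∸ 1 ∷ []))
    → (m : ℕ) → 2 ≤ m → m ≤ n
    → IsHamiltonSeq n (λ r → R r ⊎ r ≡ n) m (rewind n m T)
theorem6 (suc k) (s≤s 2≤k) R R-bounds T ham (suc (suc m′)) (s≤s (s≤s _)) M≤n =
  hamiltonian (All-rewind (suc k) (suc (suc m′)) T (inj₁ R-k) (inj₂ refl) (All.map inj₁ R-T))
  where
  R-T : All R T
  R-T = All.++⁻ˡ T (proj₁ ham)
  R-k : R k
  R-k = All.head (All.++⁻ʳ T (proj₁ ham))
  open CycleCopies k (<⇒≤ 2≤k) R T (All.map (λ {r} → proj₂ ∘ R-bounds r) R-T) ham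
  open Rewind m′ M≤n
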